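{- Let $p,q$ be primes with $2<p<q$ and suppose $\kappa+\lambda<p$. Then (i) $\kappa=\kappa'$; (ii) $\lambda'=\dfrac{\kappa+\lambda-1}{2}\ge1$; (iii) $\dfrac{p'}{\lambda'}<\dfrac{p}{\lambda}$.
   Context: Let $p,q$ be primes with $2<p<q$, and put $p'=(p-1)/2$, $q'=(q-1)/2$. Define integers $\kappa,\lambda,\kappa',\lambda'$ by $q=\kappa p+\lambda$ with $1\le\lambda\le p-1$ and $q'=\kappa'p'+\lambda'$ with $0\le\lambda'\le p'-1$. -}

module Defs where

open import Data.Nat using (ℕ; _∸_; _/_)

-- p' = (p-1)/2 (for odd p this is exact)
half-pred : ℕ → ℕ
half-pred n = (n ∸ 1) / 2

{-# OPTIONS --safe #-}
-- Write p = 1 + 2a and q = 1 + 2b. Then q = 2κa + (κ + l), so κ + l = 1 + 2m is odd and b = κa + m;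
-- as κ + l < p forces m < a, uniqueness of division by a = p' gives κ' = κ and l' = m.
-- Since q > p > l we have κ ≥ 1, hence l ≤ 2l', which gives l' ≥ 1 and 2p'l < pl ≤ 2pl'.
module Submission where

open import Defs
open import Data.Nat using (ℕ; NonZero; >-nonZero; _+_; _*_; _∸_; _/_; _%_; _≤_; _<_; zero; suc; z≤n; s≤s; s≤s⁻¹; s<s⁻¹; pred)
open import Data.Nat.Primality using (Prime; prime; composite)
open import Data.Nat.Divisibility using (divides)
open import Data.Nat.DivMod using (m*n/n≡m; m*n%n≡0; m<n⇒m%n≡m; m<n⇒m/n≡0; +-distrib-/)
open import Data.Nat.Properties
open import Data.Product using (_×_; _,_; proj₁; proj₂; ∃-syntax)
open import Data.Sum using (_⊎_; inj₁; inj₂)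
open import Relation.Nullary using (contradiction)
open import Function using (_∘_)
open import Relation.Binary.PropositionalEquality
open import Data.Nat.Tactic.RingSolver using (solve-∀)

even-or-odd : ∀ n → ∃[ m ] (n ≡ 2 * m ⊎ n ≡ 1 + 2 * m)
even-or-odd zero = 0 , inj₁ refl
even-or-odd (suc n) with even-or-odd n
... | m , inj₁ n≡2m  = m , inj₂ (cong suc n≡2m)
... | m , inj₂ n≡1+2m = suc m , inj₁ (cong suc (trans n≡1+2m (sym (+-suc m (m + 0)))))

odd-prime : ∀ {p} → Prime p → 2 < p → ∃[ a ] p ≡ 1 + 2 * a
odd-prime {p} (prime ¬composite) 2<p with even-or-odd p
... | a , inj₂ p≡1+2a = a , p≡1+2a
... | a , inj₁ p≡2a   = contradiction (composite 2<p (divides a (trans p≡2a (*-comm 2 a)))) ¬composite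

half-pred-odd : ∀ a → half-pred (1 + 2 * a) ≡ a
half-pred-odd a = trans (cong (_/ 2) (*-comm 2 a)) (m*n/n≡m a 2)

[m*n+r]/n≡m : ∀ m {n r} .{{_ : NonZero n}} → r < n → (m * n + r) / n ≡ m
[m*n+r]/n≡m m {n} {r} r<n = begin
  (m * n + r) / n    ≡⟨ +-distrib-/ (m * n) r no-carry ⟩
  m * n / n + r / n  ≡⟨ cong₂ _+_ (m*n/n≡m m n) (m<n⇒m/n≡0 r<n) ⟩
  m + 0              ≡⟨ +-identityʳ m ⟩
  m                  ∎
  where
  open ≡-Reasoning
  no-carry : m * n % n + r % n < n
  no-carry = subst₂ (λ x y → x + y < n) (sym (m*n%n≡0 m n)) (sym (m<n⇒m%n≡m r<n)) r<n

divMod-unique : ∀ {n} a b {r s} → r < n → s < n → a * n + r ≡ b * n + s → a ≡ b × r ≡ s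
divMod-unique {n} a b {r} {s} r<n s<n eq =
  a≡b , +-cancelˡ-≡ (a * n) r s (trans eq (cong (λ x → x * n + s) (sym a≡b)))
  where
  instance _ = >-nonZero (≤-<-trans z≤n r<n)
  a≡b : a ≡ b
  a≡b = trans (sym ([m*n+r]/n≡m a r<n)) (trans (cong (_/ n) eq) ([m*n+r]/n≡m b s<n))

quotient-positive : ∀ {p q κ l} → p < q → q ≡ κ * p + l → l < p → 1 ≤ κ
quotient-positive {κ = zero}  p<q refl l<p = contradiction p<q (<-asym l<p)
quotient-positive {κ = suc _} _   _    _   = s≤s z≤n

halve-odd-division : ∀ a b κ l → 1 + 2 * b ≡ κ * (1 + 2 * a) + l
  → ∃[ m ] κ + l ≡ 1 + 2 * m × b ≡ κ * a + m
halve-odd-division a b κ l q≡κp+l = halve (even-or-odd (κ + l))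
  where
  open ≡-Reasoning
  q≡2κa+κ+l : 1 + 2 * b ≡ 2 * (κ * a) + (κ + l)
  q≡2κa+κ+l = trans q≡κp+l (regroup κ a l)
    where
    regroup : ∀ κ a l → κ * (1 + 2 * a) + l ≡ 2 * (κ * a) + (κ + l)
    regroup = solve-∀
  halve : ∃[ m ] (κ + l ≡ 2 * m ⊎ κ + l ≡ 1 + 2 * m) → ∃[ m ] κ + l ≡ 1 + 2 * m × b ≡ κ * a + m
  halve (m , inj₁ κ+l≡2m) = contradiction (sym (begin
    1 + 2 * b              ≡⟨ q≡2κa+κ+l ⟩
    2 * (κ * a) + (κ + l)  ≡⟨ cong (2 * (κ * a) +_) κ+l≡2m ⟩
    2 * (κ * a) + 2 * m    ≡⟨ *-distribˡ-+ 2 (κ * a) m ⟨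
    2 * (κ * a + m)        ∎)) (even≢odd (κ * a + m) b)
  halve (m , inj₂ κ+l≡1+2m) = m , κ+l≡1+2m , *-cancelˡ-≡ b (κ * a + m) 2 (suc-injective (begin
    1 + 2 * b                  ≡⟨ q≡2κa+κ+l ⟩
    2 * (κ * a) + (κ + l)      ≡⟨ cong (2 * (κ * a) +_) κ+l≡1+2m ⟩
    2 * (κ * a) + (1 + 2 * m)  ≡⟨ +-suc (2 * (κ * a)) (2 * m) ⟩
    1 + (2 * (κ * a) + 2 * m)  ≡⟨ cong suc (*-distribˡ-+ 2 (κ * a) m) ⟨
    1 + 2 * (κ * a + m)        ∎))

1+2m<1+2a⇒m<a : ∀ {m a} → 1 + 2 * m < 1 + 2 * a → m < a
1+2m<1+2a⇒m<a {m} {a} = *-cancelˡ-< 2 m a ∘ s<s⁻¹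

halves-division : ∀ a b κ l κ' l' → 1 + 2 * b ≡ κ * (1 + 2 * a) + l → κ + l < 1 + 2 * a
  → b ≡ κ' * a + l' → l' < a → κ ≡ κ' × κ + l ≡ 1 + 2 * l'
halves-division a b κ l κ' l' q≡κp+l κ+l<p b≡κ'a+l' l'<a
  with m , κ+l≡1+2m , b≡κa+m ← halve-odd-division a b κ l q≡κp+l
  with refl , refl ← divMod-unique κ κ' (1+2m<1+2a⇒m<a (subst (_< 1 + 2 * a) κ+l≡1+2m κ+l<p)) l'<a
                                   (trans (sym b≡κa+m) b≡κ'a+l')
  = refl , κ+l≡1+2m

l≤2m⇒a*l<[1+2a]*m : ∀ a {l m} → 1 ≤ l → l ≤ 2 * m → a * l < (1 + 2 * a) * m
l≤2m⇒a*l<[1+2a]*m a {l} {m} 1≤l l≤2m = *-cancelˡ-< 2 (a * l) ((1 + 2 * a) * m) (begin-strict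
  2 * (a * l)            <⟨ m<n+m (2 * (a * l)) 1≤l ⟩
  l + 2 * (a * l)        ≡⟨ cong (l +_) (*-assoc 2 a l) ⟨
  (1 + 2 * a) * l        ≤⟨ *-monoʳ-≤ (1 + 2 * a) l≤2m ⟩
  (1 + 2 * a) * (2 * m)  ≡⟨ m*[2*n]≡2*[m*n] (1 + 2 * a) m ⟩
  2 * ((1 + 2 * a) * m)  ∎)
  where
  open ≤-Reasoning
  m*[2*n]≡2*[m*n] : ∀ x y → x * (2 * y) ≡ 2 * (x * y)
  m*[2*n]≡2*[m*n] = solve-∀

lemma7p2 : (p q κ l κ' l' : ℕ) → Prime p → Prime q → 2 < p → p < q
    → q ≡ κ * p + l → 1 ≤ l → l ≤ p ∸ 1
    → half-pred q ≡ κ' * half-pred p + l' → l' ≤ half-pred p ∸ 1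
    → κ + l < p
    → (κ ≡ κ') × ((2 * l' ≡ κ + l ∸ 1) × 1 ≤ l') × (half-pred p * l < p * l')
lemma7p2 p q κ l κ' l' p-prime q-prime 2<p p<q q≡κp+l 1≤l l≤p∸1 q'≡κ'p'+l' l'≤p'∸1 κ+l<p
  with a , refl ← odd-prime p-prime 2<p
     | b , refl ← odd-prime q-prime (<-trans 2<p p<q)
  rewrite half-pred-odd a | half-pred-odd b
  = proj₁ halves , (cong pred (sym κ+l≡1+2l') , 1≤l') , l≤2m⇒a*l<[1+2a]*m a 1≤l l≤2l'
  where
  0<a : 0 < a
  0<a = 1+2m<1+2a⇒m<a {0} (<-trans (n<1+n 1) 2<p)
  l'<a : l' < a
  l'<a = m≤pred[n]⇒suc[m]≤n ⦃ >-nonZero 0<a ⦄ l'≤p'∸1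
  halves : κ ≡ κ' × κ + l ≡ 1 + 2 * l'
  halves = halves-division a b κ l κ' l' q≡κp+l κ+l<p q'≡κ'p'+l' l'<a
  κ+l≡1+2l' : κ + l ≡ 1 + 2 * l'
  κ+l≡1+2l' = proj₂ halves
  l≤2l' : l ≤ 2 * l'
  l≤2l' = s≤s⁻¹ (subst (1 + l ≤_) κ+l≡1+2l' (+-monoˡ-≤ l (quotient-positive p<q q≡κp+l (s≤s l≤p∸1))))
  1≤l' : 1 ≤ l'
  1≤l' = *-cancelˡ-< 2 0 l' (≤-trans 1≤l l≤2l')
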